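{- Let $G=(V,E)$ be an undirected graph with weight function $w:[V]^2\to\mathbb{N}$, cost function $c:[V]^2\to\mathbb{N}^*$, and integer $B\ge0$, and let $K$ and $H$ be as defined in the context. Suppose that $H$ contains a directed path of weight $W$ from vertex $(u,i)$ to vertex $(v,j)$, for some $j\ge i$. Then there exists a $(j-i)$-bounded-cost path in $K$ with weight $W$ connecting $u$ and $v$.
   Context: $[V]^2$ is the set of unordered pairs of vertices; a non-edge of $G$ is an element of $[V]^2\setminus E$. $K$ is the complete graph on $V$ with the same weights and costs as given by $w$ and $c$, together with a self-loop at every vertex having weight $0$ and cost $1$; self-loops are regarded as non-edges of $G$. The weight of a path is the sum of its edge weights; a path in $K$ is $\beta$-bounded-cost if the non-edges of $G$ it uses have total cost at most $\beta$. The directed graph $H$ has vertex set $\{(x,i): x\in V,\ 0\le i\le B\}$ and the following arcs: for every edge $\{x,y\}\in E$ and every $0\le i\le B$, the arcs $((x,i),(y,i))$ and $((y,i),(x,i))$ with weight $w(\{x,y\})$; and for every non-edge $\{x,y\}$ of $G$ (including self-loops $x=y$, with weight $0$ and cost $1$), in both directions, and every $0\le i\le B-c(\{x,y\})$, the arc $((x,i),(y,i+c(\{x,y\})))$ with weight $w(\{x,y\})$. The weight of a directed path is the sum of its arc weights. -}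

module Defs where

open import Data.Nat using (ℕ; zero; suc; _+_; _≤_)
open import Data.Fin using (Fin; _≟_)
open import Data.Bool using (Bool; true; false; if_then_else_)
open import Data.Product using (_×_; _,_)
open import Relation.Nullary using (does)
open import Relation.Binary.PropositionalEquality using (_≡_)

-- Functions on unordered pairs are
-- represented as symmetric functions on ordered pairs of vertices; their
-- values on the diagonal are irrelevant (never used).
record WGraph (n : ℕ) : Set where
  field
    adj       : Fin n → Fin n → Bool
    adj-sym   : ∀ x y → adj x y ≡ adj y x
    adj-irrefl : ∀ x → adj x x ≡ false
    w         : Fin n → Fin n → ℕ
    w-sym     : ∀ x y → w x y ≡ w y x
    c         : Fin n → Fin n → ℕ
    c-sym     : ∀ x y → c x y ≡ c y x
    c-pos     : ∀ x y → 1 ≤ c x y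

module _ {n : ℕ} (G : WGraph n) where
  open WGraph G

  -- weight and cost in K: the complete graph on V with the same weights and
  -- costs, plus a self-loop at every vertex of weight 0 and cost 1.
  wK : Fin n → Fin n → ℕ
  wK x y = if does (x ≟ y) then 0 else w x y

  cK : Fin n → Fin n → ℕ
  cK x y = if does (x ≟ y) then 1 else c x y

  data KPath : Fin n → Fin n → Set where
    []  : ∀ {x} → KPath x x
    _∷_ : ∀ {x z} (y : Fin n) → KPath y z → KPath x z

  kWeight : ∀ {x y} → KPath x y → ℕ
  kWeight []                = 0
  kWeight (_∷_ {x = x} y p) = wK x y + kWeight p

  nonEdgeCost : ∀ {x y} → KPath x y → ℕ
  nonEdgeCost []                = 0
  nonEdgeCost (_∷_ {x = x} y p) =
    (if adj x y then 0 else cK x y) + nonEdgeCost p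

  BoundedCost : ℕ → ∀ {x y} → KPath x y → Set
  BoundedCost β p = nonEdgeCost p ≤ β

  -- Since x , y range over ordered pairs, both directions are included.
  -- Non-edges include self-loops (adj x x ≡ false), with weight 0, cost 1.
  data HArc (B : ℕ) : Fin n × ℕ → Fin n × ℕ → ℕ → Set where
    edge    : ∀ {x y i} → adj x y ≡ true → i ≤ B →
              HArc B (x , i) (y , i) (w x y)
    nonedge : ∀ {x y i} → adj x y ≡ false → i + cK x y ≤ B →
              HArc B (x , i) (y , i + cK x y) (wK x y)

  data HPath (B : ℕ) : Fin n × ℕ → Fin n × ℕ → ℕ → Set where
    []  : ∀ {x i} → i ≤ B → HPath B (x , i) (x , i) 0
    _∷_ : ∀ {a b d ω W} → HArc B a b ω → HPath B b d W →
          HPath B a d (ω + W)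

-- Forgetting the level component of every vertex of H maps an H-path to a
-- K-walk of the same weight: edge arcs become edges of G, non-edge arcs the
-- same non-edge of K.  Along an arc the level rises by exactly the non-edge
-- cost of the corresponding step, so the non-edge cost of the K-walk is the
-- total rise j − i of the level.
module Submission where

open import Defs
open import Data.Nat using (ℕ; _≤_; _∸_; _+_)
open import Data.Nat.Properties using (+-assoc; +-identityʳ; m+n∸m≡n; ≤-reflexive)
open import Data.Fin using (Fin; _≟_)
open import Data.Bool using (true; false; if_then_else_)
open import Data.Product using (Σ; _×_; _,_)
open import Relation.Nullary using (yes; no)
open import Relation.Binary.PropositionalEquality

module _ {n : ℕ} (G : WGraph n) where
  open WGraph G

  stepCost : Fin n → Fin n → ℕ
  stepCost x y = if adj x y then 0 else cK G x y

  wK-edge : ∀ {x y} → adj x y ≡ true → wK G x y ≡ w x y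
  wK-edge {x} {y} e with x ≟ y
  ... | yes refl with () ← trans (sym e) (adj-irrefl x)
  ... | no _ = refl

  stepCost-edge : ∀ {x y} → adj x y ≡ true → stepCost x y ≡ 0
  stepCost-edge e rewrite e = refl

  stepCost-nonedge : ∀ {x y} → adj x y ≡ false → stepCost x y ≡ cK G x y
  stepCost-nonedge e rewrite e = refl

  HArc-level : ∀ {B x y i k ω} → HArc G B (x , i) (y , k) ω →
               i + stepCost x y ≡ k
  HArc-level {i = i} (edge e _) =
    trans (cong (i +_) (stepCost-edge e)) (+-identityʳ i)
  HArc-level {i = i} (nonedge e _) = cong (i +_) (stepCost-nonedge e)

  HArc-weight : ∀ {B x y i k ω} → HArc G B (x , i) (y , k) ω → wK G x y ≡ ω
  HArc-weight (edge e _)    = wK-edge e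
  HArc-weight (nonedge _ _) = refl

  HPath⇒KPath : ∀ {B x y i k W} → HPath G B (x , i) (y , k) W →
                Σ (KPath G x y) λ p →
                  i + nonEdgeCost G p ≡ k × kWeight G p ≡ W
  HPath⇒KPath ([] _) = [] , +-identityʳ _ , refl
  HPath⇒KPath {x = x} {i = i} (_∷_ {b = y , l} a h)
    with p , level , weight ← HPath⇒KPath h =
    y ∷ p ,
    (begin
      i + (stepCost x y + nonEdgeCost G p) ≡⟨ sym (+-assoc i _ _) ⟩
      i + stepCost x y + nonEdgeCost G p   ≡⟨ cong (_+ nonEdgeCost G p) (HArc-level a) ⟩
      l + nonEdgeCost G p                  ≡⟨ level ⟩
      _                                    ∎) ,
    cong₂ _+_ (HArc-weight a) weight
    where open ≡-Reasoning

lemma1 : ∀ {n} (G : WGraph n) (B : ℕ) (u v : Fin n) (i j W : ℕ) →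
         i ≤ j → HPath G B (u , i) (v , j) W →
         Σ (KPath G u v) λ p → BoundedCost G (j ∸ i) p × kWeight G p ≡ W
lemma1 G B u v i j W _ h with p , level , weight ← HPath⇒KPath G h =
  p , ≤-reflexive cost≡ , weight
  where
  cost≡ : nonEdgeCost G p ≡ j ∸ i
  cost≡ = trans (sym (m+n∸m≡n i _)) (cong (_∸ i) level)
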